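{- Fix an integer base $B \ge 2$. For all positive integers $m, n$ and every integer $b \ge 1$: (1) every prime number $p$ is equidigital base $B$, i.e. $h(p)=0$; (2) $\max\{\delta(m), \delta(n)\} \le \delta(m+n) \le 1 + \max\{\delta(m), \delta(n)\}$; (3) $\delta(m) + \delta(n) - 1 \le \delta(mn) \le \delta(m) + \delta(n)$; (4) $b\,\delta(n) - b \le \delta(n^b) \le b\,\delta(n)$; (5) if $m$ and $n$ are coprime, then $\phi(mn) = \phi(m) + \phi(n)$; (6) $\phi(mn) \le \phi(m) + \phi(n)$; (7) $\phi(n^b) \le \phi(n) + \delta(b)\log_2 n$; (8) $h(mn) \ge h(m) + h(n) - 1$; (9) if $m$ is frugal and $n$ is economical, then $mn$ is economical; (10) if $m$ is frugal then $h(mn) \ge h(n)$.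
   Context: Fix an integer base $B\ge 2$. For a positive integer $n$, $\delta(n)$ is the number of base-$B$ digits of $n$, i.e. $\delta(n)=k$ iff $B^{k-1}\le n<B^k$. Define $\delta'(a)=\delta(a)$ for $a>1$ and $\delta'(1)=0$. If $n=\prod_{i=1}^r p_i^{a_i}$ is the prime power factorisation of $n$ (distinct primes $p_i$, $a_i\ge1$), put $\phi(n)=\sum_{i=1}^r \big(\delta(p_i)+\delta'(a_i)\big)$ (so $\phi(1)=0$), and $h(n)=\delta(n)-\phi(n)$. The number $n$ is equidigital if $h(n)=0$, economical if $h(n)\ge 0$, and frugal if $h(n)>0$ (so $1$ is frugal). -}

module Defs where

open import Data.Nat using (ℕ; zero; suc; _+_; _*_; _^_; _<?_)
open import Data.Nat.Divisibility using (_∣?_)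
open import Data.Nat.Primality using (prime?)
open import Data.List using (List; map; upTo)
open import Data.Nat.ListAction using (sum)
open import Data.Bool using (Bool; true; false; if_then_else_; _∧_)
open import Data.Integer using (ℤ; _-_; +_)
import Data.Integer
open import Relation.Binary.PropositionalEquality using (_≡_)
open import Relation.Nullary.Decidable using (does)

-- Number of base-B digits δ(n): the least k with n < B^k.
-- For B ≥ 2 and n ≥ 1 this is the unique k with B^(k-1) ≤ n < B^k.
-- (δ 0 = 0; δ is only ever used on positive arguments.)
-- digitsFrom B n fuel k : least j ≥ k with n < B^j, searching 'fuel' steps.
digitsFrom : ℕ → ℕ → ℕ → ℕ → ℕ
digitsFrom B n zero    k = k
digitsFrom B n (suc f) k = if does (n <? B ^ k) then k else digitsFrom B n f (suc k)

-- fuel n+1 suffices since n < 2^n ≤ B^n for n ≥ 1 (and 0 < B^0).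
δ : ℕ → ℕ → ℕ
δ B n = digitsFrom B n (suc n) 0

δ′ : ℕ → ℕ → ℕ
δ′ B zero          = 0
δ′ B (suc zero)    = 0
δ′ B (suc (suc a)) = δ B (suc (suc a))

-- p-adic valuation of n ≥ 1 for a prime p: the number of k ∈ {1,…,n}
-- with p^k ∣ n (these are exactly k = 1,…,v_p(n), since v_p(n) ≤ n).
count : (ℕ → Bool) → ℕ → ℕ
count P zero    = 0
count P (suc k) = count P k + (if P (suc k) then 1 else 0)

val : ℕ → ℕ → ℕ
val p n = count (λ k → does ((p ^ k) ∣? n)) n

contrib : ℕ → ℕ → ℕ → ℕ
contrib B n p =
  if does (prime? p) ∧ does (p ∣? n) then δ B p + δ′ B (val p n) else 0

-- φ(n) = Σ over primes p ∣ n (all such p satisfy p ≤ n) of δ(p) + δ'(v_p(n)).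
φ : ℕ → ℕ → ℕ
φ B n = sum (map (contrib B n) (upTo (suc n)))

h : ℕ → ℕ → ℤ
h B n = + δ B n - + φ B n

Equidigital Economical Frugal : ℕ → ℕ → Set
Equidigital B n = h B n ≡ + 0
Economical B n = + 0 Data.Integer.≤  h B n
Frugal B n = + 0 Data.Integer.<  h B n

-- δ n is the least k with n < B ^ k, so (2)–(4) follow by comparing m + n, m n and n ^ b with
-- powers of B.  φ n adds up δ p + δ′ (v_p n) over the primes p dividing n, and v_p is additive on
-- products and multiplicative on powers; so (5)–(7) reduce to inequalities for a single prime
-- power, using for (7) that n is at least the product of its prime divisors, hence at least
-- 2 ^ ω(n).  Finally (8)–(10) combine (3) with (6).
module Submission where

open import Defs
open import Data.Nat using (ℕ; _+_; _*_; _∸_; _^_; _≤_; _⊔_)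
open import Data.Nat.Primality using (Prime)
open import Data.Nat.Coprimality using (Coprime)
open import Data.Product using (_×_)
open import Relation.Binary.PropositionalEquality using (_≡_)

open import Data.Product using (_,_; ∃-syntax)

open import Data.Nat
  using (zero; suc; _<_; _⊓_; z≤n; s≤s; z<s; NonZero; ≢-nonZero; nonTrivial⇒n>1; _<ᵇ_; >-nonZero; _≤?_)
open import Data.Nat.Properties
open import Data.Nat.Divisibility
  using (_∣_; _∤_; divides; _∣?_; ∣-trans; _∣0; ∣1⇒≡1; ∣⇒≤; *-cancelˡ-∣)
open import Data.Nat.Primality
  using (prime?; euclidsLemma; prime⇒nonZero; prime⇒nonTrivial; prime⇒irreducible)
open import Data.Nat.Tactic.RingSolver using (solve-∀)
open import Data.List using (map; upTo; [_]; _++_)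
open import Data.List.Properties using (map-++; applyUpTo-∷ʳ)
open import Data.Nat.ListAction using (sum)
open import Data.Nat.ListAction.Properties using (sum-++)
open import Function using (id)
open import Data.Bool using (Bool; true; false; if_then_else_; _∧_)
open import Data.Bool.Properties using (∧-zeroʳ)
open import Data.Sum using (_⊎_; inj₁; inj₂; [_,_]′)
open import Data.Nat.Induction using (<-rec)
open import Relation.Binary.PropositionalEquality using (refl; sym; trans; cong; cong₂; subst; subst₂; _≢_; module ≡-Reasoning)
open import Relation.Nullary using (¬_; yes; no; contradiction)
open import Relation.Nullary.Reflects using (ofʸ; ofⁿ)
open import Relation.Nullary.Decidable using (does; dec-true; dec-false; toSum)

module Digits {B : ℕ} (1<B : 1 < B) where

  private instance
    B≢0 : NonZero B
    B≢0 = >-nonZero (<-trans z<s 1<B)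

  n<B^n : ∀ n → n < B ^ n
  n<B^n zero    = z<s
  n<B^n (suc n) = ≤-<-trans (n<B^n n) (^-monoʳ-< B 1<B (n<1+n n))

  ^-cancelʳ-< : ∀ {a c} → B ^ a < B ^ c → a < c
  ^-cancelʳ-< {a} {c} B^a<B^c = ≰⇒> λ c≤a → <⇒≱ B^a<B^c (^-monoʳ-≤ B c≤a)

  digitsFrom-upper : ∀ n f k → n < B ^ (k + f) → n < B ^ digitsFrom B n f k
  digitsFrom-upper n zero    k n<B^k = subst (λ j → n < B ^ j) (+-identityʳ k) n<B^k
  digitsFrom-upper n (suc f) k n<B^k+f with n <ᵇ B ^ k | <ᵇ-reflects-< n (B ^ k)
  ... | true  | ofʸ n<B^k = n<B^k
  ... | false | ofⁿ _     = digitsFrom-upper n f (suc k) (subst (λ j → n < B ^ j) (+-suc k f) n<B^k+f)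

  digitsFrom-least : ∀ n f k {j} → k ≤ j → n < B ^ j → digitsFrom B n f k ≤ j
  digitsFrom-least n zero    k k≤j _ = k≤j
  digitsFrom-least n (suc f) k k≤j n<B^j with n <ᵇ B ^ k | <ᵇ-reflects-< n (B ^ k)
  ... | true  | ofʸ _      = k≤j
  ... | false | ofⁿ n≮B^k with m≤n⇒m<n∨m≡n k≤j
  ...   | inj₁ k<j  = digitsFrom-least n f (suc k) k<j n<B^j
  ...   | inj₂ refl = contradiction n<B^j n≮B^k

  δ-upper : ∀ n → n < B ^ δ B n
  δ-upper n = digitsFrom-upper n (suc n) 0 (<-trans (n<B^n n) (^-monoʳ-< B 1<B (n<1+n n)))

  δ-least : ∀ {n j} → n < B ^ j → δ B n ≤ j
  δ-least {n} = digitsFrom-least n (suc n) 0 z≤n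

  δ-lower : ∀ {n j} → j < δ B n → B ^ j ≤ n
  δ-lower j<δn = ≮⇒≥ λ n<B^j → <⇒≱ j<δn (δ-least n<B^j)

  δ-pos : ∀ {n} → 1 ≤ n → 1 ≤ δ B n
  δ-pos {n} 1≤n = ^-cancelʳ-< (≤-<-trans 1≤n (δ-upper n))

  B^[δ∸1]≤n : ∀ {n} → 1 ≤ n → B ^ (δ B n ∸ 1) ≤ n
  B^[δ∸1]≤n 1≤n = δ-lower (∸-monoʳ-< z<s (δ-pos 1≤n))

  δ-mono : ∀ {m n} → m ≤ n → δ B m ≤ δ B n
  δ-mono {n = n} m≤n = δ-least (≤-<-trans m≤n (δ-upper n))

  δ-+-lower : ∀ m n → δ B m ⊔ δ B n ≤ δ B (m + n)
  δ-+-lower m n = ⊔-lub (δ-mono (m≤m+n m n)) (δ-mono (m≤n+m n m))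

  δ-+-upper : ∀ m n → δ B (m + n) ≤ 1 + (δ B m ⊔ δ B n)
  δ-+-upper m n = δ-least (begin-strict
      m + n     <⟨ +-mono-< (bound (m≤m⊔n (δ B m) (δ B n)) (δ-upper m))
                            (bound (m≤n⊔m (δ B m) (δ B n)) (δ-upper n)) ⟩
      X + X     ≡⟨ cong (X +_) (+-identityʳ X) ⟨
      2 * X     ≤⟨ *-monoˡ-≤ X 1<B ⟩
      B * X     ∎)
    where
    open ≤-Reasoning
    X : ℕ
    X = B ^ (δ B m ⊔ δ B n)
    bound : ∀ {x j} → j ≤ δ B m ⊔ δ B n → x < B ^ j → x < X
    bound j≤ x<B^j = <-≤-trans x<B^j (^-monoʳ-≤ B j≤)

  δ-*-upper : ∀ m n → δ B (m * n) ≤ δ B m + δ B n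
  δ-*-upper m n = δ-least (subst (m * n <_) (sym (^-distribˡ-+-* B (δ B m) (δ B n)))
                                (*-mono-< (δ-upper m) (δ-upper n)))

  δ-*-lower : ∀ {m n} → 1 ≤ m → 1 ≤ n → δ B m + δ B n ∸ 1 ≤ δ B (m * n)
  δ-*-lower {m} {n} 1≤m 1≤n = rearrange (δ-pos 1≤m) (δ-pos 1≤n)
      (^-cancelʳ-< (begin-strict
        B ^ (δ B m ∸ 1 + (δ B n ∸ 1))     ≡⟨ ^-distribˡ-+-* B (δ B m ∸ 1) (δ B n ∸ 1) ⟩
        B ^ (δ B m ∸ 1) * B ^ (δ B n ∸ 1) ≤⟨ *-mono-≤ (B^[δ∸1]≤n 1≤m) (B^[δ∸1]≤n 1≤n) ⟩
        m * n                             <⟨ δ-upper (m * n) ⟩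
        B ^ δ B (m * n)                   ∎))
    where
    open ≤-Reasoning
    rearrange : ∀ {x y z} → 1 ≤ x → 1 ≤ y → x ∸ 1 + (y ∸ 1) < z → x + y ∸ 1 ≤ z
    rearrange {suc x} {suc y} _ _ x+y<z rewrite +-suc x y = x+y<z

  δ-^-upper : ∀ n {b} → 1 ≤ b → δ B (n ^ b) ≤ b * δ B n
  δ-^-upper n {b} 1≤b = δ-least (subst (n ^ b <_) (trans (^-*-assoc B (δ B n) b) (cong (B ^_) (*-comm (δ B n) b)))
                                     (^-monoˡ-< b {{>-nonZero 1≤b}} (δ-upper n)))

  δ-^-lower : ∀ {n} b → 1 ≤ n → b * δ B n ∸ b ≤ δ B (n ^ b)
  δ-^-lower {n} b 1≤n = subst (_≤ δ B (n ^ b)) [δ∸1]*b≡ (<⇒≤ (^-cancelʳ-< (begin-strict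
      B ^ ((δ B n ∸ 1) * b) ≡⟨ ^-*-assoc B (δ B n ∸ 1) b ⟨
      (B ^ (δ B n ∸ 1)) ^ b ≤⟨ ^-monoˡ-≤ b (B^[δ∸1]≤n 1≤n) ⟩
      n ^ b                 <⟨ δ-upper (n ^ b) ⟩
      B ^ δ B (n ^ b)       ∎)))
    where
    open ≤-Reasoning
    [δ∸1]*b≡ : (δ B n ∸ 1) * b ≡ b * δ B n ∸ b
    [δ∸1]*b≡ = trans (*-comm (δ B n ∸ 1) b)
                     (trans (*-distribˡ-∸ b (δ B n) 1) (cong (b * δ B n ∸_) (*-identityʳ b)))

  δ′≤δ : ∀ a → δ′ B a ≤ δ B a
  δ′≤δ zero          = z≤n
  δ′≤δ (suc zero)    = z≤n
  δ′≤δ (suc (suc a)) = ≤-refl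

  δ′≡δ : ∀ {a} → 2 ≤ a → δ′ B a ≡ δ B a
  δ′≡δ {suc (suc _)} _ = refl
  δ′≡δ {1} (s≤s ())

  -- δ B 2 rather than 1: for B = 2, δ′ (1 + 1) = δ 2 = 2.
  δ′-+ : ∀ {a c} → 1 ≤ a → 1 ≤ c → δ′ B (a + c) ≤ δ B 2 + (δ′ B a + δ′ B c)
  δ′-+ {1} {1} _ _ = m≤m+n (δ B 2) 0
  δ′-+ {1} {c@(suc (suc _))} _ _ = begin
      δ B (1 + c)           ≤⟨ δ-+-upper 1 c ⟩
      1 + (δ B 1 ⊔ δ B c)   ≡⟨ cong suc (m≤n⇒m⊔n≡n (δ-mono {1} {c} (s≤s z≤n))) ⟩
      1 + δ B c             ≤⟨ +-monoˡ-≤ (δ B c) (δ-pos (s≤s z≤n)) ⟩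
      δ B 2 + δ B c         ∎
    where open ≤-Reasoning
  δ′-+ {a@(suc (suc _))} {1} _ _ = begin
      δ B (a + 1)           ≤⟨ δ-+-upper a 1 ⟩
      1 + (δ B a ⊔ δ B 1)   ≡⟨ cong suc (m≥n⇒m⊔n≡m (δ-mono {1} {a} (s≤s z≤n))) ⟩
      1 + δ B a             ≤⟨ +-mono-≤ (δ-pos (s≤s z≤n)) (m≤m+n (δ B a) 0) ⟩
      δ B 2 + (δ B a + 0)   ∎
    where open ≤-Reasoning
  δ′-+ {a@(suc (suc _))} {c@(suc (suc _))} _ _ = begin
      δ B (a + c)           ≤⟨ δ-+-upper a c ⟩
      1 + (δ B a ⊔ δ B c)   ≤⟨ +-mono-≤ (δ-pos (s≤s z≤n)) (m⊔n≤m+n (δ B a) (δ B c)) ⟩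
      δ B 2 + (δ B a + δ B c) ∎
    where open ≤-Reasoning

  δ′-* : ∀ {a b} → 1 ≤ a → 1 ≤ b → δ′ B (a * b) ≤ δ′ B a + δ B b
  δ′-* {1} {b} _ _ = subst (λ x → δ′ B x ≤ δ B b) (sym (*-identityˡ b)) (δ′≤δ b)
  δ′-* {a@(suc (suc _))} {b} _ 1≤b =
    subst (_≤ δ B a + δ B b) (sym (δ′≡δ (≤-trans (s≤s (s≤s z≤n)) (m≤m*n a b {{>-nonZero 1≤b}}))))
          (δ-*-upper a b)

prime⇒1< : ∀ {p} → Prime p → 1 < p
prime⇒1< {p} pp = nonTrivial⇒n>1 p {{prime⇒nonTrivial pp}}

prime≢1 : ∀ {p} → Prime p → p ≢ 1
prime≢1 pp refl = <-irrefl refl (prime⇒1< pp)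

^-monoʳ-∣ : ∀ p {k v} → k ≤ v → p ^ k ∣ p ^ v
^-monoʳ-∣ p {k} {v} k≤v = divides (p ^ (v ∸ k))
  (trans (cong (p ^_) (sym (m∸n+n≡m k≤v))) (^-distribˡ-+-* p (v ∸ k) k))

^-distribʳ-* : ∀ x y b → (x * y) ^ b ≡ x ^ b * y ^ b
^-distribʳ-* x y zero    = refl
^-distribʳ-* x y (suc b) = trans (cong ((x * y) *_) (^-distribʳ-* x y b)) (interchange x y (x ^ b) (y ^ b))
  where
  interchange : ∀ a c d e → a * c * (d * e) ≡ a * d * (c * e)
  interchange = solve-∀

prime∤^ : ∀ {p q} → Prime p → p ∤ q → ∀ b → p ∤ q ^ b
prime∤^ pp p∤q zero    p∣1     = prime≢1 pp (∣1⇒≡1 p∣1)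
prime∤^ pp p∤q (suc b) p∣q^1+b with euclidsLemma _ _ pp p∣q^1+b
... | inj₁ p∣q   = p∤q p∣q
... | inj₂ p∣q^b = prime∤^ pp p∤q b p∣q^b

record ExactPower (p v n : ℕ) : Set where
  constructor exactPower
  field
    cofactor      : ℕ
    factorisation : n ≡ p ^ v * cofactor
    ∤cofactor     : p ∤ cofactor

module _ {p : ℕ} where

  exactPower-∣ : ∀ {v n k} → ExactPower p v n → k ≤ v → p ^ k ∣ n
  exactPower-∣ {v} (exactPower q n≡ _) k≤v =
    ∣-trans (^-monoʳ-∣ p k≤v) (divides q (trans n≡ (*-comm (p ^ v) q)))

  exactPower-∤ : ∀ {v n k} .{{_ : NonZero p}} → ExactPower p v n → v < k → p ^ k ∤ n
  exactPower-∤ {v} {n} (exactPower q n≡ p∤q) v<k p^k∣n =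
    p∤q (*-cancelˡ-∣ (p ^ v) {{m^n≢0 p v}} (subst₂ _∣_ (*-comm p (p ^ v)) n≡
      (∣-trans (^-monoʳ-∣ p v<k) p^k∣n)))

  exactPower-≤ : ∀ {v n} → 1 < p → ExactPower p v n → v ≤ n
  exactPower-≤ {v} {n} 1<p (exactPower q n≡ p∤q) = <⇒≤ (begin-strict
      v         <⟨ Digits.n<B^n 1<p v ⟩
      p ^ v     ≤⟨ m≤m*n (p ^ v) q {{q≢0}} ⟩
      p ^ v * q ≡⟨ n≡ ⟨
      n         ∎)
    where
    open ≤-Reasoning
    q≢0 : NonZero q
    q≢0 = ≢-nonZero λ { refl → p∤q (p ∣0) }

count-threshold : ∀ (P : ℕ → Bool) v → (∀ k → k ≤ v → P k ≡ true) → (∀ k → v < k → P k ≡ false) →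
                  ∀ j → count P j ≡ j ⊓ v
count-threshold P v below above zero = refl
count-threshold P v below above (suc j) with suc j ≤? v
... | yes 1+j≤v rewrite below (suc j) 1+j≤v | count-threshold P v below above j
                      | m≤n⇒m⊓n≡m 1+j≤v | m≤n⇒m⊓n≡m (<⇒≤ 1+j≤v) = +-comm j 1
... | no 1+j≰v  rewrite above (suc j) (≰⇒> 1+j≰v) | count-threshold P v below above j
                      | m≥n⇒m⊓n≡n (≤-pred (≰⇒> 1+j≰v)) | m≥n⇒m⊓n≡n (<⇒≤ (≰⇒> 1+j≰v)) = +-identityʳ v

module _ {p : ℕ} (1<p : 1 < p) where

  private instance
    p≢0 : NonZero p
    p≢0 = >-nonZero (<-trans z<s 1<p)

  val-exactPower : ∀ {v n} → ExactPower p v n → val p n ≡ v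
  val-exactPower {v} {n} pv∥n = trans
    (count-threshold _ v (λ k k≤v → dec-true  (p ^ k ∣? n) (exactPower-∣ pv∥n k≤v))
                         (λ k v<k → dec-false (p ^ k ∣? n) (exactPower-∤ pv∥n v<k)) n)
    (m≥n⇒m⊓n≡n (exactPower-≤ 1<p pv∥n))

  exactPower-exists : ∀ {n} → 1 ≤ n → ∃[ v ] ExactPower p v n
  exactPower-exists {n} = <-rec (λ n → 1 ≤ n → ∃[ v ] ExactPower p v n) split n
    where
    split : ∀ n → (∀ {q} → q < n → 1 ≤ q → ∃[ v ] ExactPower p v q) → 1 ≤ n → ∃[ v ] ExactPower p v n
    split n rec 1≤n with p ∣? n
    ... | no  p∤n = 0 , exactPower n (sym (*-identityˡ n)) p∤n
    ... | yes (divides q n≡q*p) with rec q<n 1≤q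
      where
      1≤q : 1 ≤ q
      1≤q = n≢0⇒n>0 λ { refl → <⇒≱ 1≤n (≤-reflexive n≡q*p) }
      q<n : q < n
      q<n = subst (q <_) (sym n≡q*p) (m<m*n q p {{>-nonZero 1≤q}} 1<p)
    ...   | v , exactPower r q≡ p∤r = suc v , exactPower r n≡ p∤r
      where
      n≡ : n ≡ p ^ suc v * r
      n≡ = trans n≡q*p (trans (cong (_* p) q≡) (rotate (p ^ v) r p))
        where
        rotate : ∀ a b c → a * b * c ≡ c * a * b
        rotate = solve-∀

  val-∤ : ∀ {n} → p ∤ n → val p n ≡ 0
  val-∤ {n} p∤n = val-exactPower (exactPower n (sym (*-identityˡ n)) p∤n)

  val-pos : ∀ {n} → 1 ≤ n → p ∣ n → 1 ≤ val p n
  val-pos {n} 1≤n p∣n with exactPower-exists 1≤n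
  ... | v , pv∥n = subst (1 ≤_) (sym (val-exactPower pv∥n))
    (≮⇒≥ λ v<1 → exactPower-∤ pv∥n v<1 (subst (_∣ n) (sym (*-identityʳ p)) p∣n))

exactPower-* : ∀ {p a c m n} → Prime p → ExactPower p a m → ExactPower p c n → ExactPower p (a + c) (m * n)
exactPower-* {p} {a} {c} pp (exactPower q m≡ p∤q) (exactPower r n≡ p∤r) = exactPower (q * r)
  (trans (cong₂ _*_ m≡ n≡) (trans (interchange (p ^ a) q (p ^ c) r) (cong (_* (q * r)) (sym (^-distribˡ-+-* p a c)))))
  λ p∣q*r → [ p∤q , p∤r ]′ (euclidsLemma q r pp p∣q*r)
  where
  interchange : ∀ x y z w → x * y * (z * w) ≡ x * z * (y * w)
  interchange = solve-∀

exactPower-^ : ∀ {p a n} → Prime p → ExactPower p a n → ∀ b → ExactPower p (a * b) (n ^ b)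
exactPower-^ {p} {a} pp (exactPower q n≡ p∤q) b = exactPower (q ^ b)
  (trans (cong (_^ b) n≡) (trans (^-distribʳ-* (p ^ a) q b) (cong (_* q ^ b) (^-*-assoc p a b))))
  (prime∤^ pp p∤q b)

module _ {p : ℕ} (pp : Prime p) where

  private
    1<p : 1 < p
    1<p = prime⇒1< pp

  val-* : ∀ {m n} → 1 ≤ m → 1 ≤ n → val p (m * n) ≡ val p m + val p n
  val-* 1≤m 1≤n with exactPower-exists 1<p 1≤m | exactPower-exists 1<p 1≤n
  ... | a , pa∥m | c , pc∥n = trans (val-exactPower 1<p (exactPower-* pp pa∥m pc∥n))
    (sym (cong₂ _+_ (val-exactPower 1<p pa∥m) (val-exactPower 1<p pc∥n)))

  val-^ : ∀ {n} → 1 ≤ n → ∀ b → val p (n ^ b) ≡ val p n * b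
  val-^ 1≤n b with exactPower-exists 1<p 1≤n
  ... | a , pa∥n = trans (val-exactPower 1<p (exactPower-^ pp pa∥n b))
    (sym (cong (_* b) (val-exactPower 1<p pa∥n)))

  val-self : val p p ≡ 1
  val-self = val-exactPower 1<p
    (exactPower 1 (sym (trans (*-identityʳ (p * 1)) (*-identityʳ p))) λ p∣1 → prime≢1 pp (∣1⇒≡1 p∣1))

sumBelow : ℕ → (ℕ → ℕ) → ℕ
sumBelow zero    f = 0
sumBelow (suc N) f = sumBelow N f + f N

sum-map-upTo : ∀ f N → sum (map f (upTo N)) ≡ sumBelow N f
sum-map-upTo f zero    = refl
sum-map-upTo f (suc N) = begin
    sum (map f (upTo (suc N)))        ≡⟨ cong (λ ks → sum (map f ks)) (applyUpTo-∷ʳ id N) ⟨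
    sum (map f (upTo N ++ [ N ]))     ≡⟨ cong sum (map-++ f (upTo N) [ N ]) ⟩
    sum (map f (upTo N) ++ [ f N ])   ≡⟨ sum-++ (map f (upTo N)) [ f N ] ⟩
    sum (map f (upTo N)) + (f N + 0)  ≡⟨ cong₂ _+_ (sum-map-upTo f N) (+-identityʳ (f N)) ⟩
    sumBelow N f + f N                ∎
  where open ≡-Reasoning

module _ {f g : ℕ → ℕ} where

  sumBelow-cong : (∀ k → f k ≡ g k) → ∀ N → sumBelow N f ≡ sumBelow N g
  sumBelow-cong f≗g zero    = refl
  sumBelow-cong f≗g (suc N) = cong₂ _+_ (sumBelow-cong f≗g N) (f≗g N)

  sumBelow-mono-≤ : (∀ k → f k ≤ g k) → ∀ N → sumBelow N f ≤ sumBelow N g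
  sumBelow-mono-≤ f≤g zero    = z≤n
  sumBelow-mono-≤ f≤g (suc N) = +-mono-≤ (sumBelow-mono-≤ f≤g N) (f≤g N)

  sumBelow-distrib-+ : ∀ N → sumBelow N (λ k → f k + g k) ≡ sumBelow N f + sumBelow N g
  sumBelow-distrib-+ zero    = refl
  sumBelow-distrib-+ (suc N) = trans (cong (_+ (f N + g N)) (sumBelow-distrib-+ N))
                                     (+-+-interchange (sumBelow N f) (sumBelow N g) (f N) (g N))
    where
    +-+-interchange : ∀ a b c d → a + b + (c + d) ≡ a + c + (b + d)
    +-+-interchange = solve-∀

sumBelow-*ʳ : ∀ f c N → sumBelow N (λ k → f k * c) ≡ sumBelow N f * c
sumBelow-*ʳ f c zero    = refl
sumBelow-*ʳ f c (suc N) = trans (cong (_+ f N * c) (sumBelow-*ʳ f c N)) (sym (*-distribʳ-+ c (sumBelow N f) (f N)))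

sumBelow-vanishing : ∀ f {M N} → M ≤ N → (∀ k → M ≤ k → k < N → f k ≡ 0) → sumBelow N f ≡ sumBelow M f
sumBelow-vanishing f {M} {N} M≤N vanish with m≤n⇒m<n∨m≡n M≤N
... | inj₂ refl = refl
sumBelow-vanishing f {M} {suc N} _ vanish | inj₁ (s≤s M≤N) = begin
    sumBelow N f + f N ≡⟨ cong (sumBelow N f +_) (vanish N M≤N ≤-refl) ⟩
    sumBelow N f + 0   ≡⟨ +-identityʳ (sumBelow N f) ⟩
    sumBelow N f       ≡⟨ sumBelow-vanishing f M≤N (λ k M≤k k<N → vanish k M≤k (m<n⇒m<1+n k<N)) ⟩
    sumBelow M f       ∎
  where open ≡-Reasoning

isPrimeDivisor : ℕ → ℕ → Bool
isPrimeDivisor n k = does (prime? k) ∧ does (k ∣? n)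

module _ {n k : ℕ} where

  isPrimeDivisor-true : Prime k → k ∣ n → isPrimeDivisor n k ≡ true
  isPrimeDivisor-true pk k∣n = cong₂ _∧_ (dec-true (prime? k) pk) (dec-true (k ∣? n) k∣n)

  isPrimeDivisor-¬prime : ¬ Prime k → isPrimeDivisor n k ≡ false
  isPrimeDivisor-¬prime ¬pk = cong (_∧ does (k ∣? n)) (dec-false (prime? k) ¬pk)

  isPrimeDivisor-∤ : k ∤ n → isPrimeDivisor n k ≡ false
  isPrimeDivisor-∤ k∤n = trans (cong (does (prime? k) ∧_) (dec-false (k ∣? n) k∤n)) (∧-zeroʳ _)

data PrimeDivisorView (n k : ℕ) : Set where
  primeDivisor    : Prime k → k ∣ n → isPrimeDivisor n k ≡ true → PrimeDivisorView n k
  notPrimeDivisor : isPrimeDivisor n k ≡ false → PrimeDivisorView n k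

primeDivisor? : ∀ n k → PrimeDivisorView n k
primeDivisor? n k with prime? k | k ∣? n
... | yes pk  | yes k∣n = primeDivisor pk k∣n (isPrimeDivisor-true pk k∣n)
... | yes _   | no k∤n  = notPrimeDivisor (isPrimeDivisor-∤ k∤n)
... | no ¬pk  | _       = notPrimeDivisor (isPrimeDivisor-¬prime ¬pk)

ωBelow : ℕ → ℕ → ℕ
ωBelow N n = sumBelow N (λ k → if isPrimeDivisor n k then 1 else 0)

radicalBelow : ℕ → ℕ → ℕ
radicalBelow zero    n = 1
radicalBelow (suc N) n = radicalBelow N n * (if isPrimeDivisor n N then N else 1)

prime∣radicalBelow⇒< : ∀ {p} N n → Prime p → p ∣ radicalBelow N n → p < N
prime∣radicalBelow⇒< zero    n pp p∣1 = contradiction (∣1⇒≡1 p∣1) (prime≢1 pp)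
prime∣radicalBelow⇒< (suc N) n pp p∣R with primeDivisor? n N
... | primeDivisor pN _ eq rewrite eq with euclidsLemma _ _ pp p∣R
...   | inj₁ p∣R′ = m<n⇒m<1+n (prime∣radicalBelow⇒< N n pp p∣R′)
...   | inj₂ p∣N  = s≤s (∣⇒≤ {{prime⇒nonZero pN}} p∣N)
prime∣radicalBelow⇒< (suc N) n pp p∣R | notPrimeDivisor eq rewrite eq =
  m<n⇒m<1+n (prime∣radicalBelow⇒< N n pp (subst (_ ∣_) (*-identityʳ _) p∣R))

radicalBelow-∣ : ∀ N n → radicalBelow N n ∣ n
radicalBelow-∣ zero    n = divides n (sym (*-identityʳ n))
radicalBelow-∣ (suc N) n with primeDivisor? n N | radicalBelow-∣ N n
... | notPrimeDivisor eq | R∣n rewrite eq = subst (_∣ n) (sym (*-identityʳ _)) R∣n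
... | primeDivisor pN N∣n eq | divides t n≡t*R rewrite eq
    with euclidsLemma t (radicalBelow N n) pN (subst (N ∣_) n≡t*R N∣n)
...   | inj₂ N∣R = contradiction (prime∣radicalBelow⇒< N n pN N∣R) (<-irrefl refl)
...   | inj₁ (divides s t≡s*N) =
  divides s (trans n≡t*R (trans (cong (_* radicalBelow N n) t≡s*N) (*-assoc-comm s N (radicalBelow N n))))
  where
  *-assoc-comm : ∀ a b c → a * b * c ≡ a * (c * b)
  *-assoc-comm = solve-∀

2^ωBelow≤radicalBelow : ∀ N n → 2 ^ ωBelow N n ≤ radicalBelow N n
2^ωBelow≤radicalBelow zero    n = ≤-refl
2^ωBelow≤radicalBelow (suc N) n = begin
    2 ^ (ωBelow N n + indicator)    ≡⟨ ^-distribˡ-+-* 2 (ωBelow N n) indicator ⟩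
    2 ^ ωBelow N n * 2 ^ indicator  ≤⟨ *-mono-≤ (2^ωBelow≤radicalBelow N n) step ⟩
    radicalBelow (suc N) n          ∎
  where
  open ≤-Reasoning
  indicator : ℕ
  indicator = if isPrimeDivisor n N then 1 else 0
  step : 2 ^ indicator ≤ (if isPrimeDivisor n N then N else 1)
  step with primeDivisor? n N
  ... | primeDivisor pN _ eq rewrite eq = prime⇒1< pN
  ... | notPrimeDivisor eq   rewrite eq = ≤-refl

2^ωBelow≤ : ∀ N {n} → 1 ≤ n → 2 ^ ωBelow N n ≤ n
2^ωBelow≤ N {n} 1≤n = ≤-trans (2^ωBelow≤radicalBelow N n) (∣⇒≤ {{>-nonZero 1≤n}} (radicalBelow-∣ N n))

-- The digits δ p + δ′ a spent on p ^ a in φ; the value 0 at a = 0 makes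
-- contrib B n p ≡ powerCost B p (val p n) hold for every prime p.
powerCost : ℕ → ℕ → ℕ → ℕ
powerCost B p zero    = 0
powerCost B p (suc a) = δ B p + δ′ B (suc a)

powerCost-pos : ∀ {B p a} → 1 ≤ a → powerCost B p a ≡ δ B p + δ′ B a
powerCost-pos {a = suc _} _ = refl

powerCost-+-disjoint : ∀ {B p} a c → a ≡ 0 ⊎ c ≡ 0 → powerCost B p (a + c) ≡ powerCost B p a + powerCost B p c
powerCost-+-disjoint a c (inj₁ refl) = refl
powerCost-+-disjoint {B} {p} a c (inj₂ refl) =
  trans (cong (powerCost B p) (+-identityʳ a)) (sym (+-identityʳ (powerCost B p a)))

module _ {B : ℕ} (1<B : 1 < B) where
  open Digits 1<B

  powerCost-+ : ∀ {p} → 2 ≤ p → ∀ a c → powerCost B p (a + c) ≤ powerCost B p a + powerCost B p c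
  powerCost-+ _ zero c = ≤-refl
  powerCost-+ {p} _ a@(suc _) zero = ≤-reflexive (powerCost-+-disjoint {B} {p} a 0 (inj₂ refl))
  powerCost-+ {p} 2≤p a@(suc _) c@(suc _) = begin
      δ B p + δ′ B (a + c)                         ≤⟨ +-monoʳ-≤ (δ B p) (δ′-+ {a} {c} (s≤s z≤n) (s≤s z≤n)) ⟩
      δ B p + (δ B 2 + (δ′ B a + δ′ B c))          ≤⟨ +-monoʳ-≤ (δ B p) (+-monoˡ-≤ _ (δ-mono 2≤p)) ⟩
      δ B p + (δ B p + (δ′ B a + δ′ B c))          ≡⟨ regroup (δ B p) (δ′ B a) (δ′ B c) ⟩
      (δ B p + δ′ B a) + (δ B p + δ′ B c)          ∎
    where
    open ≤-Reasoning
    regroup : ∀ x y z → x + (x + (y + z)) ≡ x + y + (x + z)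
    regroup = solve-∀

  powerCost-* : ∀ {p a b} → 1 ≤ a → 1 ≤ b → powerCost B p (a * b) ≤ powerCost B p a + δ B b
  powerCost-* {p} {a@(suc _)} {b@(suc _)} 1≤a 1≤b = begin
      δ B p + δ′ B (a * b)            ≤⟨ +-monoʳ-≤ (δ B p) (δ′-* 1≤a 1≤b) ⟩
      δ B p + (δ′ B a + δ B b)        ≡⟨ +-assoc (δ B p) (δ′ B a) (δ B b) ⟨
      δ B p + δ′ B a + δ B b          ∎
    where open ≤-Reasoning

module _ {B n k : ℕ} where

  contrib-¬prime : ¬ Prime k → contrib B n k ≡ 0
  contrib-¬prime ¬pk = cong (λ b → if b then δ B k + δ′ B (val k n) else 0) (isPrimeDivisor-¬prime ¬pk)

  contrib-∤ : k ∤ n → contrib B n k ≡ 0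
  contrib-∤ k∤n = cong (λ b → if b then δ B k + δ′ B (val k n) else 0) (isPrimeDivisor-∤ k∤n)

  contrib-prime : Prime k → 1 ≤ n → contrib B n k ≡ powerCost B k (val k n)
  contrib-prime pk 1≤n with toSum (k ∣? n)
  ... | inj₁ k∣n = trans (cong (λ b → if b then δ B k + δ′ B (val k n) else 0) (isPrimeDivisor-true pk k∣n))
                        (sym (powerCost-pos (val-pos (prime⇒1< pk) 1≤n k∣n)))
  ... | inj₂ k∤n = trans (contrib-∤ k∤n) (cong (powerCost B k) (sym (val-∤ (prime⇒1< pk) k∤n)))

φ≡sumBelow : ∀ {B n N} → 1 ≤ n → n < N → φ B n ≡ sumBelow N (contrib B n)
φ≡sumBelow {B} {n} 1≤n n<N = trans (sum-map-upTo (contrib B n) (suc n))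
  (sym (sumBelow-vanishing (contrib B n) n<N λ k n<k _ → contrib-∤ λ k∣n → <⇒≱ n<k (∣⇒≤ {{>-nonZero 1≤n}} k∣n)))

φ-prime : ∀ {B p} → Prime p → φ B p ≡ δ B p
φ-prime {B} {p} pp = begin
    φ B p                                  ≡⟨ sum-map-upTo (contrib B p) (suc p) ⟩
    sumBelow p (contrib B p) + contrib B p p ≡⟨ cong₂ _+_ (sumBelow-vanishing (contrib B p) z≤n below-p)
                                                          (contrib-prime pp (<⇒≤ (prime⇒1< pp))) ⟩
    powerCost B p (val p p)                ≡⟨ cong (powerCost B p) (val-self pp) ⟩
    δ B p + 0                              ≡⟨ +-identityʳ (δ B p) ⟩
    δ B p                                  ∎
  where
  open ≡-Reasoning
  below-p : ∀ k → 0 ≤ k → k < p → contrib B p k ≡ 0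
  below-p k _ k<p with toSum (prime? k) | toSum (k ∣? p)
  ... | inj₂ ¬pk | _     = contrib-¬prime ¬pk
  ... | inj₁ _   | inj₂ k∤p = contrib-∤ k∤p
  ... | inj₁ pk  | inj₁ k∣p with prime⇒irreducible pp k∣p
  ...   | inj₁ k≡1 = contradiction k≡1 (prime≢1 pk)
  ...   | inj₂ k≡p = contradiction k≡p (<⇒≢ k<p)

module _ {B m n : ℕ} (1≤m : 1 ≤ m) (1≤n : 1 ≤ n) where

  private
    1≤m*n : 1 ≤ m * n
    1≤m*n = *-mono-≤ 1≤m 1≤n

  contrib-* : ∀ {k} → Prime k → contrib B (m * n) k ≡ powerCost B k (val k m + val k n)
  contrib-* {k} pk = trans (contrib-prime pk 1≤m*n) (cong (powerCost B k) (val-* pk 1≤m 1≤n))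

  contrib-*-coprime : Coprime m n → ∀ k → contrib B (m * n) k ≡ contrib B m k + contrib B n k
  contrib-*-coprime coprime k with toSum (prime? k)
  ... | inj₂ ¬pk = trans (contrib-¬prime ¬pk) (sym (cong₂ _+_ (contrib-¬prime ¬pk) (contrib-¬prime ¬pk)))
  ... | inj₁ pk  = begin
      contrib B (m * n) k                               ≡⟨ contrib-* pk ⟩
      powerCost B k (val k m + val k n)                 ≡⟨ powerCost-+-disjoint (val k m) (val k n) notBoth ⟩
      powerCost B k (val k m) + powerCost B k (val k n) ≡⟨ cong₂ _+_ (contrib-prime pk 1≤m) (contrib-prime pk 1≤n) ⟨
      contrib B m k + contrib B n k                     ∎
    where
    open ≡-Reasoning
    notBoth : val k m ≡ 0 ⊎ val k n ≡ 0
    notBoth with toSum (k ∣? m) | toSum (k ∣? n)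
    ... | inj₂ k∤m | _        = inj₁ (val-∤ (prime⇒1< pk) k∤m)
    ... | inj₁ _   | inj₂ k∤n = inj₂ (val-∤ (prime⇒1< pk) k∤n)
    ... | inj₁ k∣m | inj₁ k∣n = contradiction (coprime (k∣m , k∣n)) (prime≢1 pk)

  contrib-*-≤ : 1 < B → ∀ k → contrib B (m * n) k ≤ contrib B m k + contrib B n k
  contrib-*-≤ 1<B k with toSum (prime? k)
  ... | inj₂ ¬pk = subst (_≤ contrib B m k + contrib B n k) (sym (contrib-¬prime ¬pk)) z≤n
  ... | inj₁ pk  = begin
      contrib B (m * n) k                               ≡⟨ contrib-* pk ⟩
      powerCost B k (val k m + val k n)                 ≤⟨ powerCost-+ 1<B (prime⇒1< pk) (val k m) (val k n) ⟩
      powerCost B k (val k m) + powerCost B k (val k n) ≡⟨ cong₂ _+_ (contrib-prime pk 1≤m) (contrib-prime pk 1≤n) ⟨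
      contrib B m k + contrib B n k                     ∎
    where open ≤-Reasoning

  private
    N : ℕ
    N = suc (m * n)

    φ-+≡sumBelow : φ B m + φ B n ≡ sumBelow N (λ k → contrib B m k + contrib B n k)
    φ-+≡sumBelow = trans (cong₂ _+_ (φ≡sumBelow 1≤m (s≤s (m≤m*n m n {{>-nonZero 1≤n}})))
                                    (φ≡sumBelow 1≤n (s≤s (m≤n*m n m {{>-nonZero 1≤m}}))))
                         (sym (sumBelow-distrib-+ N))

  φ-*-coprime : Coprime m n → φ B (m * n) ≡ φ B m + φ B n
  φ-*-coprime coprime = begin
      φ B (m * n)                          ≡⟨ φ≡sumBelow 1≤m*n ≤-refl ⟩
      sumBelow N (contrib B (m * n))       ≡⟨ sumBelow-cong (contrib-*-coprime coprime) N ⟩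
      sumBelow N (λ k → contrib B m k + contrib B n k) ≡⟨ φ-+≡sumBelow ⟨
      φ B m + φ B n                        ∎
    where open ≡-Reasoning

  φ-*-≤ : 1 < B → φ B (m * n) ≤ φ B m + φ B n
  φ-*-≤ 1<B = begin
      φ B (m * n)                          ≡⟨ φ≡sumBelow 1≤m*n ≤-refl ⟩
      sumBelow N (contrib B (m * n))       ≤⟨ sumBelow-mono-≤ (contrib-*-≤ 1<B) N ⟩
      sumBelow N (λ k → contrib B m k + contrib B n k) ≡⟨ φ-+≡sumBelow ⟨
      φ B m + φ B n                        ∎
    where open ≤-Reasoning

module _ {B n b : ℕ} (1<B : 1 < B) (1≤n : 1 ≤ n) (1≤b : 1 ≤ b) where

  private
    instance
      n≢0 : NonZero n
      n≢0 = >-nonZero 1≤n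

    1≤n^b : 1 ≤ n ^ b
    1≤n^b = m^n>0 n b

    n≤n^b : n ≤ n ^ b
    n≤n^b = subst (_≤ n ^ b) (^-identityʳ n) (^-monoʳ-≤ n 1≤b)

    N : ℕ
    N = suc (n ^ b)

    indicator : ℕ → ℕ
    indicator k = if isPrimeDivisor n k then 1 else 0

  contrib-^-≤ : ∀ k → contrib B (n ^ b) k ≤ contrib B n k + indicator k * δ B b
  contrib-^-≤ k with toSum (prime? k)
  ... | inj₂ ¬pk = subst (_≤ contrib B n k + indicator k * δ B b) (sym (contrib-¬prime ¬pk)) z≤n
  ... | inj₁ pk  = begin
      contrib B (n ^ b) k            ≡⟨ contrib-prime pk 1≤n^b ⟩
      powerCost B k (val k (n ^ b))  ≡⟨ cong (powerCost B k) (val-^ pk 1≤n b) ⟩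
      powerCost B k (val k n * b)    ≤⟨ bound ⟩
      contrib B n k + indicator k * δ B b ∎
    where
    open ≤-Reasoning
    bound : powerCost B k (val k n * b) ≤ contrib B n k + indicator k * δ B b
    bound with toSum (k ∣? n)
    ... | inj₂ k∤n = subst (λ v → powerCost B k (v * b) ≤ contrib B n k + indicator k * δ B b) (sym (val-∤ (prime⇒1< pk) k∤n)) z≤n
    ... | inj₁ k∣n = begin
        powerCost B k (val k n * b)               ≤⟨ powerCost-* 1<B (val-pos (prime⇒1< pk) 1≤n k∣n) 1≤b ⟩
        powerCost B k (val k n) + δ B b           ≡⟨ cong₂ _+_ (contrib-prime pk 1≤n) (*-identityˡ (δ B b)) ⟨
        contrib B n k + 1 * δ B b                 ≡⟨ cong (λ i → contrib B n k + (if i then 1 else 0) * δ B b)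
                                                          (isPrimeDivisor-true pk k∣n) ⟨
        contrib B n k + indicator k * δ B b       ∎

  φ-^-≤ : φ B (n ^ b) ≤ φ B n + ωBelow N n * δ B b
  φ-^-≤ = begin
      φ B (n ^ b)                                      ≡⟨ φ≡sumBelow 1≤n^b ≤-refl ⟩
      sumBelow N (contrib B (n ^ b))                   ≤⟨ sumBelow-mono-≤ contrib-^-≤ N ⟩
      sumBelow N (λ k → contrib B n k + indicator k * δ B b)
        ≡⟨ sumBelow-distrib-+ N ⟩
      sumBelow N (contrib B n) + sumBelow N (λ k → indicator k * δ B b)
        ≡⟨ cong₂ _+_ (sym (φ≡sumBelow 1≤n (s≤s n≤n^b))) (sumBelow-*ʳ indicator (δ B b) N) ⟩
      φ B n + ωBelow N n * δ B b                       ∎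
    where open ≤-Reasoning

  2^φ-^-≤ : 2 ^ φ B (n ^ b) ≤ 2 ^ φ B n * n ^ δ B b
  2^φ-^-≤ = begin
      2 ^ φ B (n ^ b)                        ≤⟨ ^-monoʳ-≤ 2 φ-^-≤ ⟩
      2 ^ (φ B n + ωBelow N n * δ B b)       ≡⟨ ^-distribˡ-+-* 2 (φ B n) (ωBelow N n * δ B b) ⟩
      2 ^ φ B n * 2 ^ (ωBelow N n * δ B b)   ≡⟨ cong (2 ^ φ B n *_) (^-*-assoc 2 (ωBelow N n) (δ B b)) ⟨
      2 ^ φ B n * (2 ^ ωBelow N n) ^ δ B b   ≤⟨ *-monoʳ-≤ (2 ^ φ B n) (^-monoˡ-≤ (δ B b) (2^ωBelow≤ N 1≤n)) ⟩
      2 ^ φ B n * n ^ δ B b                  ∎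
    where open ≤-Reasoning

-- Opened only here: its prefix +_ makes ℕ sections such as (x +_) ambiguous.
open import Data.Integer using (ℤ; +_; _-_; _≥_) renaming (_+_ to _+ℤ_)
import Data.Integer as ℤ
import Data.Integer.Properties as ℤ
open import Data.Integer.Tactic.RingSolver using () renaming (solve-∀ to ℤ-solve-∀)

prime-equidigital : ∀ {B p} → Prime p → Equidigital B p
prime-equidigital {B} {p} pp = trans (cong (λ x → + δ B p - + x) (φ-prime pp)) (ℤ.+-inverseʳ (+ δ B p))

module _ {B m n : ℕ} (1<B : 1 < B) (1≤m : 1 ≤ m) (1≤n : 1 ≤ n) where
  open Digits 1<B

  h-*-≥ : h B (m * n) ≥ h B m +ℤ h B n - + 1
  h-*-≥ = begin
      h B m +ℤ h B n - + 1                                    ≡⟨ regroup (+ δ B m) (+ φ B m) (+ δ B n) (+ φ B n) ⟩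
      (+ (δ B m + δ B n) - + 1) - + (φ B m + φ B n)           ≡⟨ cong (_- + (φ B m + φ B n)) δ-sum∸1 ⟩
      + (δ B m + δ B n ∸ 1) - + (φ B m + φ B n)               ≤⟨ ℤ.+-mono-≤ (ℤ.+≤+ (δ-*-lower 1≤m 1≤n))
                                                                            (ℤ.neg-mono-≤ (ℤ.+≤+ (φ-*-≤ 1≤m 1≤n 1<B))) ⟩
      + δ B (m * n) - + φ B (m * n)                           ∎
    where
    open ℤ.≤-Reasoning
    regroup : ∀ a b c d → (a - b) +ℤ (c - d) - + 1 ≡ (a +ℤ c - + 1) - (b +ℤ d)
    regroup = ℤ-solve-∀
    δ-sum∸1 : + (δ B m + δ B n) - + 1 ≡ + (δ B m + δ B n ∸ 1)
    δ-sum∸1 = trans (ℤ.m-n≡m⊖n (δ B m + δ B n) 1) (ℤ.⊖-≥ (≤-trans (δ-pos 1≤m) (m≤m+n (δ B m) (δ B n))))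

  frugal-h-*-≥ : Frugal B m → h B (m * n) ≥ h B n
  frugal-h-*-≥ frugal = begin
      h B n                   ≡⟨ one-in-one-out (h B n) ⟩
      + 1 +ℤ h B n - + 1      ≤⟨ ℤ.+-monoˡ-≤ (ℤ.- + 1) (ℤ.+-monoˡ-≤ (h B n) (ℤ.i<j⇒suc[i]≤j frugal)) ⟩
      h B m +ℤ h B n - + 1    ≤⟨ h-*-≥ ⟩
      h B (m * n)             ∎
    where
    open ℤ.≤-Reasoning
    one-in-one-out : ∀ i → i ≡ + 1 +ℤ i - + 1
    one-in-one-out = ℤ-solve-∀

proposition1 : (B : ℕ) → 2 ≤ B → (m n b : ℕ) → 1 ≤ m → 1 ≤ n → 1 ≤ b →
    -- (1) every prime is equidigital
    ((p : ℕ) → Prime p → Equidigital B p)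
    -- (2)
    × ((δ B m ⊔ δ B n) ≤ δ B (m + n) × δ B (m + n) ≤ 1 + (δ B m ⊔ δ B n))
    -- (3)
    × (δ B m + δ B n ∸ 1 ≤ δ B (m * n) × δ B (m * n) ≤ δ B m + δ B n)
    -- (4)
    × (b * δ B n ∸ b ≤ δ B (n ^ b) × δ B (n ^ b) ≤ b * δ B n)
    -- (5)
    × (Coprime m n → φ B (m * n) ≡ φ B m + φ B n)
    -- (6)
    × φ B (m * n) ≤ φ B m + φ B n
    -- (7) φ(n^b) ≤ φ(n) + δ(b) log₂ n, exponentiated base 2
    × 2 ^ φ B (n ^ b) ≤ 2 ^ φ B n * n ^ δ B b
    -- (8)
    × h B (m * n) ≥ h B m +ℤ h B n - + 1
    -- (9)
    × (Frugal B m → Economical B n → Economical B (m * n))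
    -- (10)
    × (Frugal B m → h B (m * n) ≥ h B n)
proposition1 B 1<B m n b 1≤m 1≤n 1≤b =
    (λ p → prime-equidigital)
  , (δ-+-lower m n , δ-+-upper m n)
  , (δ-*-lower 1≤m 1≤n , δ-*-upper m n)
  , (δ-^-lower b 1≤n , δ-^-upper n 1≤b)
  , φ-*-coprime 1≤m 1≤n
  , φ-*-≤ 1≤m 1≤n 1<B
  , 2^φ-^-≤ 1<B 1≤n 1≤b
  , h-*-≥ 1<B 1≤m 1≤n
  , (λ frugal economical → ℤ.≤-trans economical (frugal-h-*-≥ 1<B 1≤m 1≤n frugal))
  , frugal-h-*-≥ 1<B 1≤m 1≤n
  where open Digits 1<B
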